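{- Let $G=([n],E)$ be a graph, let $\mathbf p=(p_1,\dots,p_n)$ be a strict vector coloring of $G$, and let $\tilde G(\mathbf p)$ be the tensegrity framework obtained from $G$ by declaring every edge a strut (no bars, no cables) with vectors $p_i$. Then: (i) if $\tilde G(\mathbf p)$ is universally completable, then $\mathbf p$ is the unique optimal vector coloring of $G$ (i.e., every optimal vector coloring $\mathbf q$ satisfies $\mathrm{Gram}(q_1,\dots,q_n)=\mathrm{Gram}(p_1,\dots,p_n)$); (ii) if $\mathbf p$ is optimal as a vector coloring, then $G$ is uniquely vector colorable if and only if $\tilde G(\mathbf p)$ is universally completable.
   Context: For $t\ge2$, a vector $t$-coloring of $G$ is an assignment of real unit vectors $p_i$ with $p_i^Tp_j\le-1/(t-1)$ for all edges $ij$; it is a strict vector $t$-coloring if equality holds on every edge. The vector chromatic number $\chi_v(G)$ is the least $t$ admitting a vector $t$-coloring, and a vector coloring is optimal if it is a vector $\chi_v(G)$-coloring. $G$ is uniquely vector colorable if any two optimal vector colorings have the same Gram matrix $\mathrm{Gram}(p_1,\dots,p_n)=(p_i^Tp_j)_{i,j}$. A tensegrity framework with struts $S$ only: a framework $\tilde G(\mathbf p)$ dominates $\tilde G(\mathbf q)$ (the $q_i$ in a real space of any dimension) if $q_i^Tq_i=p_i^Tp_i$ for all $i$ and $q_i^Tq_j\le p_i^Tp_j$ for all edges $ij$; it is universally completable if every framework it dominates has the same Gram matrix. -}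

module Defs where

open import Level using (0ℓ)
open import Data.Nat using (ℕ; zero; suc)
open import Data.Fin using (Fin; zero; suc)
open import Data.Product using (Σ; ∃; _×_; _,_)
open import Relation.Nullary using (¬_)
open import Algebra.Structures using (IsCommutativeRing)
open import Relation.Binary.Structures using (IsTotalOrder)
open import Function.Bundles using (_⇔_)

-- The real numbers, axiomatised as a complete ordered field
-- (any two such are isomorphic, so quantifying over them is faithful).
record RealField : Set₁ where
  infixl 6 _+_
  infixl 7 _*_
  infix 4 _≈_ _≤_
  field
    Carrier : Set
    _≈_ : Carrier → Carrier → Set
    _+_ : Carrier → Carrier → Carrier
    _*_ : Carrier → Carrier → Carrier
    -_  : Carrier → Carrier
    0# : Carrier
    1# : Carrier
    _≤_ : Carrier → Carrier → Set
    isCommutativeRing : IsCommutativeRing _≈_ _+_ _*_ -_ 0# 1#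
    isTotalOrder : IsTotalOrder _≈_ _≤_
    0≉1 : ¬ (0# ≈ 1#)
    inverse : ∀ x → ¬ (x ≈ 0#) → ∃ λ y → x * y ≈ 1#
    +-monoˡ-≤ : ∀ {x y} z → x ≤ y → x + z ≤ y + z
    *-nonneg : ∀ {x y} → 0# ≤ x → 0# ≤ y → 0# ≤ x * y
    complete : (S : Carrier → Set) → (∃ λ x → S x) →
               (∃ λ b → ∀ x → S x → x ≤ b) →
               ∃ λ s → (∀ x → S x → x ≤ s) ×
                       (∀ b → (∀ x → S x → x ≤ b) → s ≤ b)

record Graph (n : ℕ) : Set₁ where
  field
    Adj : Fin n → Fin n → Set
    Adj-sym : ∀ {i j} → Adj i j → Adj j i
    Adj-irrefl : ∀ {i} → ¬ Adj i i

module Notions (R : RealField) where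
  open RealField R

  sumF : (d : ℕ) → (Fin d → Carrier) → Carrier
  sumF zero f = 0#
  sumF (suc d) f = f zero + sumF d (λ k → f (suc k))

  dot : {d : ℕ} → (Fin d → Carrier) → (Fin d → Carrier) → Carrier
  dot {d} x y = sumF d (λ k → x k * y k)

  -- c = -1/(t-1), i.e. (t - 1) * c = -1  (meaningful for t ≥ 2)
  IsNegRecip : Carrier → Carrier → Set
  IsNegRecip t c = (t + - 1#) * c ≈ - 1#

  AtLeastTwo : Carrier → Set
  AtLeastTwo t = 1# + 1# ≤ t

  Unit : ∀ {n d} → (Fin n → Fin d → Carrier) → Set
  Unit p = ∀ i → dot (p i) (p i) ≈ 1#

  IsVectorColoring : ∀ {n d} → Graph n → Carrier → (Fin n → Fin d → Carrier) → Set
  IsVectorColoring G t p =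
    AtLeastTwo t × Unit p ×
    (∀ i j → Graph.Adj G i j → ∀ c → IsNegRecip t c → dot (p i) (p j) ≤ c)

  IsStrictVectorColoring : ∀ {n d} → Graph n → Carrier → (Fin n → Fin d → Carrier) → Set
  IsStrictVectorColoring G t p =
    AtLeastTwo t × Unit p ×
    (∀ i j → Graph.Adj G i j → ∀ c → IsNegRecip t c → dot (p i) (p j) ≈ c)

  IsVectorChromaticNumber : ∀ {n} → Graph n → Carrier → Set
  IsVectorChromaticNumber {n} G t =
    (∃ λ d → Σ (Fin n → Fin d → Carrier) λ p → IsVectorColoring G t p) ×
    (∀ t' d (q : Fin n → Fin d → Carrier) → IsVectorColoring G t' q → t ≤ t')

  IsOptimal : ∀ {n d} → Graph n → (Fin n → Fin d → Carrier) → Set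
  IsOptimal G p = ∃ λ t → IsVectorChromaticNumber G t × IsVectorColoring G t p

  SameGram : ∀ {n d d'} → (Fin n → Fin d → Carrier) → (Fin n → Fin d' → Carrier) → Set
  SameGram p q = ∀ i j → dot (p i) (p j) ≈ dot (q i) (q j)

  UniquelyVectorColorable : ∀ {n} → Graph n → Set
  UniquelyVectorColorable {n} G =
    ∀ d d' (p : Fin n → Fin d → Carrier) (q : Fin n → Fin d' → Carrier) →
    IsOptimal G p → IsOptimal G q → SameGram p q

  -- tensegrity framework G~(p) with all edges struts: p dominates q
  Dominates : ∀ {n d d'} → Graph n → (Fin n → Fin d → Carrier) → (Fin n → Fin d' → Carrier) → Set
  Dominates G p q =
    (∀ i → dot (q i) (q i) ≈ dot (p i) (p i)) ×
    (∀ i j → Graph.Adj G i j → dot (q i) (q j) ≤ dot (p i) (p j))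

  UniversallyCompletable : ∀ {n d} → Graph n → (Fin n → Fin d → Carrier) → Set
  UniversallyCompletable {n} G p =
    ∀ d' (q : Fin n → Fin d' → Carrier) → Dominates G p q → SameGram q p

module Submission where

-- Write c(t) = -1/(t-1) for the edge bound of a vector t-coloring.  The whole
-- argument rests on one order-theoretic fact: c is monotone on [2, ∞), being
-- the negative of a reciprocal of the increasing positive quantity t - 1.
--
-- After noting that equality of Gram matrices is an
-- equivalence, the coloring part rests on two observations relating
-- optimality and domination of all-strut frameworks:
--   * if p is a strict t-coloring and q is an optimal coloring, then p
--     dominates q, because χ_v(G) ≤ t gives q_iᵀq_j ≤ c(χ_v) ≤ c(t) = p_iᵀp_j;
--   * if p is an optimal coloring, every q dominated by p is again optimal,
--     since domination preserves unit length and the edge bounds.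
-- Part (i) is the first observation followed by universal completability;
-- part (ii) combines both observations with part (i).

open import Defs
open import Data.Nat using (ℕ)
open import Data.Fin using (Fin)
open import Data.Product using (_×_; _,_; ∃; proj₁; proj₂)
open import Data.Sum using (inj₁; inj₂)
open import Data.Empty using (⊥-elim)
open import Relation.Nullary using (¬_)
open import Function.Bundles using (_⇔_; mk⇔)
open import Algebra.Bundles using (CommutativeRing)
open import Relation.Binary.Bundles using (Poset)
open import Relation.Binary.Structures using (IsTotalOrder)
import Algebra.Properties.Ring as RingProperties
import Relation.Binary.Reasoning.PartialOrder as PosetReasoning

module OrderedFieldFacts (R : RealField) where
  open RealField R
  open Notions R using (IsNegRecip; AtLeastTwo)

  commutativeRing : CommutativeRing _ _
  commutativeRing = record { isCommutativeRing = isCommutativeRing }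

  open CommutativeRing commutativeRing
    using (sym; trans; +-congˡ; +-congʳ; -‿cong; *-congˡ; *-congʳ; *-assoc; *-comm; +-comm;
           +-assoc; +-identityˡ; +-identityʳ; -‿inverseˡ; -‿inverseʳ;
           *-identityʳ; ring)
  open RingProperties ring
    using (-‿distribʳ-*; -‿involutive; -0#≈0#; x[y-z]≈xy-xz)
  open IsTotalOrder isTotalOrder
    using (isPartialOrder; total; antisym; ≤-respˡ-≈; ≤-respʳ-≈) renaming (trans to ≤-trans)

  poset : Poset _ _ _
  poset = record { isPartialOrder = isPartialOrder }

  open PosetReasoning poset

  infixl 6 _-_
  _-_ : Carrier → Carrier → Carrier
  x - y = x + - y

  ≤⇒0≤diff : ∀ {x y} → x ≤ y → 0# ≤ y - x
  ≤⇒0≤diff {x} {y} x≤y = begin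
    0#     ≈⟨ -‿inverseʳ x ⟨
    x - x  ≤⟨ +-monoˡ-≤ (- x) x≤y ⟩
    y - x  ∎

  0≤diff⇒≤ : ∀ {x y} → 0# ≤ y - x → x ≤ y
  0≤diff⇒≤ {x} {y} 0≤y-x = begin
    x              ≈⟨ +-identityˡ x ⟨
    0# + x         ≤⟨ +-monoˡ-≤ x 0≤y-x ⟩
    (y - x) + x    ≈⟨ +-assoc y (- x) x ⟩
    y + (- x + x)  ≈⟨ +-congˡ (-‿inverseˡ x) ⟩
    y + 0#         ≈⟨ +-identityʳ y ⟩
    y              ∎

  neg-antitone : ∀ {x y} → x ≤ y → - y ≤ - x
  neg-antitone {x} {y} x≤y = 0≤diff⇒≤ (begin
    0#         ≤⟨ ≤⇒0≤diff x≤y ⟩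
    y - x      ≈⟨ +-congʳ (-‿involutive y) ⟨
    - - y - x  ≈⟨ +-comm (- - y) (- x) ⟩
    - x - - y  ∎)

  ≤0⇒0≤neg : ∀ {x} → x ≤ 0# → 0# ≤ - x
  ≤0⇒0≤neg x≤0 = ≤-respˡ-≈ -0#≈0# (neg-antitone x≤0)

  0≤neg⇒≤0 : ∀ {x} → 0# ≤ - x → x ≤ 0#
  0≤neg⇒≤0 {x} 0≤-x = ≤-respˡ-≈ (-‿involutive x) (≤-respʳ-≈ -0#≈0# (neg-antitone 0≤-x))

  -- The field is nontrivially ordered: 0 ≤ 1, since 1 ≤ 0 would give
  -- 0 ≤ (-1)(-1) = 1 and hence 0 = 1.
  0≤1 : 0# ≤ 1#
  0≤1 with total 0# 1#
  ... | inj₁ 0≤1 = 0≤1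
  ... | inj₂ 1≤0 = ⊥-elim (0≉1 (antisym (≤-respʳ-≈ square-of-minus-one (*-nonneg 0≤-1 0≤-1)) 1≤0))
    where
    0≤-1 : 0# ≤ - 1#
    0≤-1 = ≤0⇒0≤neg 1≤0
    square-of-minus-one : - 1# * - 1# ≈ 1#
    square-of-minus-one = trans (sym (-‿distribʳ-* (- 1#) 1#))
                                (trans (-‿cong (*-identityʳ (- 1#))) (-‿involutive 1#))

  ≥1⇒≉0 : ∀ {x} → 1# ≤ x → ¬ (x ≈ 0#)
  ≥1⇒≉0 1≤x x≈0 = 0≉1 (antisym 0≤1 (≤-respʳ-≈ x≈0 1≤x))

  -- The inverse of a nonnegative element is nonnegative: otherwise
  -- a * (-u) = -1 would be a product of nonnegatives.
  inverse-nonneg : ∀ {a u} → 0# ≤ a → a * u ≈ 1# → 0# ≤ u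
  inverse-nonneg {a} {u} 0≤a au≈1 with total 0# u
  ... | inj₁ 0≤u = 0≤u
  ... | inj₂ u≤0 = ⊥-elim (0≉1 (antisym 0≤1 (0≤neg⇒≤0 0≤-1)))
    where
    0≤-1 : 0# ≤ - 1#
    0≤-1 = ≤-respʳ-≈ (trans (sym (-‿distribʳ-* a u)) (-‿cong au≈1))
                     (*-nonneg 0≤a (≤0⇒0≤neg u≤0))

  difference-of-inverses : ∀ {a b u v} → a * u ≈ 1# → b * v ≈ 1# →
                           u * v * (b - a) ≈ u - v
  difference-of-inverses {a} {b} {u} {v} au≈1 bv≈1 = begin-equality
    u * v * (b - a)          ≈⟨ x[y-z]≈xy-xz (u * v) b a ⟩
    u * v * b - u * v * a    ≈⟨ +-congˡ (-‿cong uva≈v) ⟩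
    u * v * b - v            ≈⟨ +-congʳ uvb≈u ⟩
    u - v                    ∎
    where
    uvb≈u : u * v * b ≈ u
    uvb≈u = trans (*-assoc u v b)
                  (trans (*-congˡ (trans (*-comm v b) bv≈1)) (*-identityʳ u))
    uva≈v : u * v * a ≈ v
    uva≈v = trans (*-congʳ (*-comm u v))
                  (trans (*-assoc v u a)
                         (trans (*-congˡ (trans (*-comm u a) au≈1)) (*-identityʳ v)))

  inverse-antitone : ∀ {a b u v} → 0# ≤ a → a ≤ b → a * u ≈ 1# → b * v ≈ 1# → v ≤ u
  inverse-antitone {a} {b} {u} {v} 0≤a a≤b au≈1 bv≈1 = 0≤diff⇒≤ (begin
    0#               ≤⟨ *-nonneg (*-nonneg 0≤u 0≤v) (≤⇒0≤diff a≤b) ⟩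
    u * v * (b - a)  ≈⟨ difference-of-inverses au≈1 bv≈1 ⟩
    u - v            ∎)
    where
    0≤u : 0# ≤ u
    0≤u = inverse-nonneg 0≤a au≈1
    0≤v : 0# ≤ v
    0≤v = inverse-nonneg (≤-trans 0≤a a≤b) bv≈1

  ≥2⇒1≤pred : ∀ {t} → AtLeastTwo t → 1# ≤ t - 1#
  ≥2⇒1≤pred {t} 2≤t = begin
    1#              ≈⟨ +-identityʳ 1# ⟨
    1# + 0#         ≈⟨ +-congˡ (-‿inverseʳ 1#) ⟨
    1# + (1# - 1#)  ≈⟨ +-assoc 1# 1# (- 1#) ⟨
    (1# + 1#) - 1#  ≤⟨ +-monoˡ-≤ (- 1#) 2≤t ⟩
    t - 1#          ∎

  negRecip⇒inverse : ∀ {t c} → IsNegRecip t c → (t - 1#) * - c ≈ 1#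
  negRecip⇒inverse {t} {c} e =
    trans (sym (-‿distribʳ-* (t - 1#) c)) (trans (-‿cong e) (-‿involutive 1#))

  negRecip-exists : ∀ {t} → AtLeastTwo t → ∃ λ c → IsNegRecip t c
  negRecip-exists {t} 2≤t with inverse (t - 1#) (≥1⇒≉0 (≥2⇒1≤pred 2≤t))
  ... | u , e = - u , trans (sym (-‿distribʳ-* (t - 1#) u)) (-‿cong e)

  negRecip-monotone : ∀ {s t cs ct} → AtLeastTwo s → s ≤ t →
                      IsNegRecip s cs → IsNegRecip t ct → cs ≤ ct
  negRecip-monotone {s} {t} {cs} {ct} 2≤s s≤t es et = begin
    cs      ≈⟨ -‿involutive cs ⟨
    - - cs  ≤⟨ neg-antitone (inverse-antitone 0≤s-1 (+-monoˡ-≤ (- 1#) s≤t)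
                              (negRecip⇒inverse es) (negRecip⇒inverse et)) ⟩
    - - ct  ≈⟨ -‿involutive ct ⟩
    ct      ∎
    where
    0≤s-1 : 0# ≤ s - 1#
    0≤s-1 = ≤-trans 0≤1 (≥2⇒1≤pred 2≤s)

module GramFacts (R : RealField) {n : ℕ} where
  open RealField R using (Carrier)
  open Notions R using (SameGram)
  open CommutativeRing (OrderedFieldFacts.commutativeRing R) using (sym; trans)

  sameGram-sym : ∀ {d d'} (p : Fin n → Fin d → Carrier) (q : Fin n → Fin d' → Carrier) →
                 SameGram p q → SameGram q p
  sameGram-sym p q p~q i j = sym (p~q i j)

  sameGram-trans : ∀ {d d' d''} (p : Fin n → Fin d → Carrier)
                   (q : Fin n → Fin d' → Carrier) (r : Fin n → Fin d'' → Carrier) →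
                   SameGram p q → SameGram q r → SameGram p r
  sameGram-trans p q r p~q q~r i j = trans (p~q i j) (q~r i j)

module ColoringFacts (R : RealField) {n : ℕ} (G : Graph n) where
  open RealField R
  open Notions R
  open OrderedFieldFacts R using (poset; negRecip-exists; negRecip-monotone)
  open IsTotalOrder isTotalOrder using (reflexive) renaming (trans to ≤-trans)
  open CommutativeRing (OrderedFieldFacts.commutativeRing R) using (sym; trans)
  open GramFacts R using (sameGram-sym; sameGram-trans)
  open PosetReasoning poset

  strict⇒coloring : ∀ {d} {t} (p : Fin n → Fin d → Carrier) →
                    IsStrictVectorColoring G t p → IsVectorColoring G t p
  strict⇒coloring p (2≤t , unit , edges) =
    2≤t , unit , λ i j ij c e → reflexive (edges i j ij c e)

  dominated-coloring : ∀ {d d'} {t}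
                       (p : Fin n → Fin d → Carrier) (q : Fin n → Fin d' → Carrier) →
                       IsVectorColoring G t p → Dominates G p q → IsVectorColoring G t q
  dominated-coloring p q (2≤t , unit , edges) (norms , inner) =
    2≤t , (λ i → trans (norms i) (unit i)) ,
    λ i j ij c e → ≤-trans (inner i j ij) (edges i j ij c e)

  dominated-optimal : ∀ {d d'}
                      (p : Fin n → Fin d → Carrier) (q : Fin n → Fin d' → Carrier) →
                      IsOptimal G p → Dominates G p q → IsOptimal G q
  dominated-optimal p q (χ , isχ , coloring) dom = χ , isχ , dominated-coloring p q coloring dom

  -- A strict vector t-coloring p dominates every optimal coloring q: with
  -- χ = χ_v(G) ≤ t we get q_iᵀq_j ≤ -1/(χ-1) ≤ -1/(t-1) = p_iᵀp_j on edges.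
  strict-dominates-optimal : ∀ {d d'} {t}
                             (p : Fin n → Fin d → Carrier) (q : Fin n → Fin d' → Carrier) →
                             IsStrictVectorColoring G t p → IsOptimal G q → Dominates G p q
  strict-dominates-optimal {t = t} p q p-strict@(_ , unitp , edgesp)
                           (χ , (_ , least) , (2≤χ , unitq , edgesq)) =
    (λ i → trans (unitq i) (sym (unitp i))) , edge-bound
    where
    χ≤t : χ ≤ t
    χ≤t = least t _ p (strict⇒coloring p p-strict)
    boundχ : ∃ λ c → IsNegRecip χ c
    boundχ = negRecip-exists 2≤χ
    boundt : ∃ λ c → IsNegRecip t c
    boundt = negRecip-exists (proj₁ p-strict)
    edge-bound : ∀ i j → Graph.Adj G i j → dot (q i) (q j) ≤ dot (p i) (p j)
    edge-bound i j ij = begin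
      dot (q i) (q j)  ≤⟨ edgesq i j ij (proj₁ boundχ) (proj₂ boundχ) ⟩
      proj₁ boundχ     ≤⟨ negRecip-monotone 2≤χ χ≤t (proj₂ boundχ) (proj₂ boundt) ⟩
      proj₁ boundt     ≈⟨ edgesp i j ij (proj₁ boundt) (proj₂ boundt) ⟨
      dot (p i) (p j)  ∎

  common-gram⇒uniquelyColorable : ∀ {d} (p : Fin n → Fin d → Carrier) →
    (∀ d' (q : Fin n → Fin d' → Carrier) → IsOptimal G q → SameGram q p) →
    UniquelyVectorColorable G
  common-gram⇒uniquelyColorable p common d₁ d₂ q₁ q₂ opt₁ opt₂ =
    sameGram-trans q₁ p q₂ (common d₁ q₁ opt₁) (sameGram-sym q₂ p (common d₂ q₂ opt₂))

  universallyCompletable⇒common-gram : ∀ {d} {t} (p : Fin n → Fin d → Carrier) →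
    IsStrictVectorColoring G t p → UniversallyCompletable G p →
    ∀ d' (q : Fin n → Fin d' → Carrier) → IsOptimal G q → SameGram q p
  universallyCompletable⇒common-gram p p-strict complete d' q opt =
    complete d' q (strict-dominates-optimal p q p-strict opt)

  -- For an optimal coloring p, unique vector colorability makes the framework
  -- universally completable, since everything p dominates is optimal.
  uniquelyColorable⇒universallyCompletable : ∀ {d} (p : Fin n → Fin d → Carrier) →
    IsOptimal G p → UniquelyVectorColorable G → UniversallyCompletable G p
  uniquelyColorable⇒universallyCompletable {d = d} p opt unique d' q dom =
    sameGram-sym p q (unique d d' p q opt (dominated-optimal p q opt dom))

theorem4p6 : (R : RealField) → let open RealField R in let open Notions R in
    (n : ℕ) (G : Graph n) (d : ℕ) (p : Fin n → Fin d → Carrier) (t : Carrier) →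
    IsStrictVectorColoring G t p →
    ((UniversallyCompletable G p →
    ∀ d' (q : Fin n → Fin d' → Carrier) → IsOptimal G q → SameGram q p) ×
    (IsOptimal G p → (UniquelyVectorColorable G ⇔ UniversallyCompletable G p)))
theorem4p6 R n G d p t p-strict =
    universallyCompletable⇒common-gram p p-strict
  , λ p-optimal → mk⇔ (uniquelyColorable⇒universallyCompletable p p-optimal)
                      (λ complete → common-gram⇒uniquelyColorable p
                                      (universallyCompletable⇒common-gram p p-strict complete))
  where open ColoringFacts R G
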